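{- Let $s,b\ge1$ be integers and $\{a_i\}$ the $(s,b)$-Generacci sequence. Then $a_i=i$ for all $1\le i\le(s+1)b+1$.
   Context: For fixed integers $s,b\ge1$ and an increasing sequence of positive integers $\{a_i\}_{i\ge1}$, the bins are $\mathcal{B}_n=\{a_{b(n-1)+1},\dots,a_{bn}\}$ for $n\ge1$, with $\mathcal{B}_j=\emptyset$ for $j\le0$. A decomposition $m=a_{\ell_1}+\cdots+a_{\ell_k}$ with $a_{\ell_1}>\cdots>a_{\ell_k}$ is an $(s,b)$-Generacci legal decomposition if $\{a_{\ell_i},a_{\ell_{i+1}}\}\not\subset\mathcal{B}_{j-s}\cup\cdots\cup\mathcal{B}_j$ for all $i,j$. The $(s,b)$-Generacci sequence is the increasing sequence of positive integers $\{a_i\}$ in which each $a_i$ is the smallest positive integer with no $(s,b)$-Generacci legal decomposition using elements of $\{a_1,\dots,a_{i-1}\}$. -}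

module Defs where

open import Data.Nat using (ℕ; zero; suc; _+_; _*_; _∸_; _≤_; _<_; _>_)
open import Data.List using (List; map)
open import Data.Nat.ListAction using (sum)
open import Data.List.Relation.Unary.All using (All)
open import Data.List.Relation.Unary.Linked using (Linked)
open import Data.Product using (_×_; Σ; ∃)
open import Relation.Nullary using (¬_)
open import Relation.Binary.PropositionalEquality using (_≡_)

-- Sequences are maps a : ℕ → ℕ used 1-based: the terms are a 1, a 2, ...
-- (the value a 0 is irrelevant).  Bins are described on indices:
-- index ℓ lies in bin 𝓑_n (n ≥ 1) iff b(n-1)+1 ≤ ℓ ≤ bn, i.e. a ℓ ∈ 𝓑_n.
InBin : (b n ℓ : ℕ) → Set
InBin b n ℓ = (1 ≤ n) × (b * (n ∸ 1) + 1 ≤ ℓ) × (ℓ ≤ b * n)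

-- ℓ lies in 𝓑_{j-s} ∪ ⋯ ∪ 𝓑_j  (bins with index ≤ 0 are empty, so
-- it suffices to consider n ≥ 1 and j ∈ ℕ; j = 0 gives the empty window).
InWindow : (s b j ℓ : ℕ) → Set
InWindow s b j ℓ = ∃ λ n → (n ≤ j) × (j ≤ n + s) × InBin b n ℓ

LegalPair : (s b ℓ ℓ' : ℕ) → Set
LegalPair s b ℓ ℓ' = ∀ j → ¬ (InWindow s b j ℓ × InWindow s b j ℓ')

LegalDecomp : (s b : ℕ) (a : ℕ → ℕ) (i m : ℕ) (ls : List ℕ) → Set
LegalDecomp s b a i m ls =
  All (λ ℓ → (1 ≤ ℓ) × (ℓ < i)) ls
  × Linked _>_ ls
  × Linked (LegalPair s b) ls
  × (sum (map a ls) ≡ m)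

HasLegalDecomp : (s b : ℕ) (a : ℕ → ℕ) (i m : ℕ) → Set
HasLegalDecomp s b a i m = Σ (List ℕ) (LegalDecomp s b a i m)

IsGeneracci : (s b : ℕ) (a : ℕ → ℕ) → Set
IsGeneracci s b a =
  (∀ i → 1 ≤ i → 1 ≤ a i)
  × (∀ i → 1 ≤ i → a i < a (suc i))
  × (∀ i → 1 ≤ i → ¬ HasLegalDecomp s b a i (a i))
  × (∀ i → 1 ≤ i → ∀ m → 1 ≤ m → m < a i → HasLegalDecomp s b a i m)

-- Since a is increasing and positive, a i ≥ i.  Conversely, if a i > i for an
-- index i ≤ (s+1)b+1, then i itself has a legal decomposition over
-- a₁,…,a_{i-1}.  Those indices are at most (s+1)b, so all lie in the window
-- 𝓑₁ ∪ ⋯ ∪ 𝓑_{s+1}; hence no two summands may be consecutive and the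
-- decomposition has a single summand a ℓ = ℓ < i (by strong induction), absurd.
module Submission where

open import Defs
open import Data.Nat using (ℕ; zero; suc; _+_; _*_; _≤_; _<_; z≤n; s≤s)
open import Data.Nat.Properties
open import Data.Nat.Induction using (<-rec)
open import Data.List using ([]; _∷_)
open import Data.List.Relation.Unary.All using (_∷_)
open import Data.List.Relation.Unary.Linked using (_∷_)
open import Data.Product using (∃; _×_; _,_)
open import Data.Empty using (⊥-elim)
open import Relation.Nullary using (¬_; yes; no)
open import Relation.Binary.PropositionalEquality using (_≡_; sym; trans; subst)

inBin-≤ : ∀ b k ℓ → 1 ≤ ℓ → ℓ ≤ b * k → ∃ λ n → n ≤ k × InBin b n ℓ
inBin-≤ b zero ℓ 1≤ℓ ℓ≤0 rewrite *-zeroʳ b = ⊥-elim (<⇒≱ 1≤ℓ ℓ≤0)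
inBin-≤ b (suc k) ℓ 1≤ℓ ℓ≤b[1+k] with ℓ ≤? b * k
... | yes ℓ≤bk with inBin-≤ b k ℓ 1≤ℓ ℓ≤bk
...   | n , n≤k , ℓ∈𝓑ₙ = n , m≤n⇒m≤1+n n≤k , ℓ∈𝓑ₙ
inBin-≤ b (suc k) ℓ 1≤ℓ ℓ≤b[1+k] | no ℓ≰bk =
  suc k , ≤-refl , s≤s z≤n , subst (_≤ ℓ) (+-comm 1 (b * k)) (≰⇒> ℓ≰bk) , ℓ≤b[1+k]

inWindow-initial : ∀ s b ℓ → 1 ≤ ℓ → ℓ ≤ (s + 1) * b → InWindow s b (s + 1) ℓ
inWindow-initial s b ℓ 1≤ℓ ℓ≤ with inBin-≤ b (s + 1) ℓ 1≤ℓ (subst (ℓ ≤_) (*-comm (s + 1) b) ℓ≤)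
... | n , n≤1+s , ℓ∈𝓑ₙ@(1≤n , _) =
  n , n≤1+s , subst (_≤ n + s) (+-comm 1 s) (+-monoˡ-≤ s 1≤n) , ℓ∈𝓑ₙ

¬LegalPair-initial : ∀ s b ℓ ℓ' → 1 ≤ ℓ → ℓ ≤ (s + 1) * b → 1 ≤ ℓ' → ℓ' ≤ (s + 1) * b →
                     ¬ LegalPair s b ℓ ℓ'
¬LegalPair-initial s b ℓ ℓ' 1≤ℓ ℓ≤ 1≤ℓ' ℓ'≤ legal =
  legal (s + 1) (inWindow-initial s b ℓ 1≤ℓ ℓ≤ , inWindow-initial s b ℓ' 1≤ℓ' ℓ'≤)

≤-of-increasing : (a : ℕ → ℕ) → 1 ≤ a 1 → (∀ i → 1 ≤ i → a i < a (suc i)) →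
                  ∀ i → 1 ≤ i → i ≤ a i
≤-of-increasing a 1≤a₁ inc (suc zero)    _ = 1≤a₁
≤-of-increasing a 1≤a₁ inc (suc (suc i)) _ =
  ≤-trans (s≤s (≤-of-increasing a 1≤a₁ inc (suc i) (s≤s z≤n))) (inc (suc i) (s≤s z≤n))

module _ (s b : ℕ) (a : ℕ → ℕ) where

  ¬LegalDecomp-self : ∀ i → 1 ≤ i → i ≤ (s + 1) * b + 1 →
                      (∀ ℓ → 1 ≤ ℓ → ℓ < i → a ℓ ≡ ℓ) → ¬ HasLegalDecomp s b a i i
  ¬LegalDecomp-self i 1≤i i≤ a≡id ([] , _ , _ , _ , 0≡i) = <⇒≢ 1≤i 0≡i
  ¬LegalDecomp-self i 1≤i i≤ a≡id ((ℓ ∷ []) , ((1≤ℓ , ℓ<i) ∷ _) , _ , _ , aℓ+0≡i) =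
    <⇒≢ ℓ<i (trans (sym (a≡id ℓ 1≤ℓ ℓ<i)) (trans (sym (+-identityʳ (a ℓ))) aℓ+0≡i))
  ¬LegalDecomp-self i 1≤i i≤ a≡id
    ((ℓ ∷ ℓ' ∷ _) , ((1≤ℓ , ℓ<i) ∷ (1≤ℓ' , ℓ'<i) ∷ _) , _ , (legal ∷ _) , _) =
    ¬LegalPair-initial s b ℓ ℓ' 1≤ℓ (below ℓ<i) 1≤ℓ' (below ℓ'<i) legal
    where
    below : ∀ {ℓ} → ℓ < i → ℓ ≤ (s + 1) * b
    below ℓ<i = ≤-pred (≤-trans ℓ<i (subst (i ≤_) (+-comm ((s + 1) * b) 1) i≤))

lemma2p1 : (s b : ℕ) → 1 ≤ s → 1 ≤ b → (a : ℕ → ℕ) → IsGeneracci s b a →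
    ∀ i → 1 ≤ i → i ≤ (s + 1) * b + 1 → a i ≡ i
lemma2p1 s b _ _ a (pos , inc , _ , minimal) = <-rec P step
  where
  P : ℕ → Set
  P i = 1 ≤ i → i ≤ (s + 1) * b + 1 → a i ≡ i

  step : ∀ i → (∀ {ℓ} → ℓ < i → P ℓ) → P i
  step i ih 1≤i i≤ = ≤-antisym ai≤i (≤-of-increasing a (pos 1 ≤-refl) inc i 1≤i)
    where
    a≡id : ∀ ℓ → 1 ≤ ℓ → ℓ < i → a ℓ ≡ ℓ
    a≡id ℓ 1≤ℓ ℓ<i = ih ℓ<i 1≤ℓ (≤-trans (<⇒≤ ℓ<i) i≤)

    ai≤i : a i ≤ i
    ai≤i = ≮⇒≥ λ i<ai → ¬LegalDecomp-self s b a i 1≤i i≤ a≡id (minimal i 1≤i i 1≤i i<ai)
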